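{- Fix integers $r>s\ge1$. Then $M_{r,s,\infty}$ and $B_{r,s,\infty}$ are subgroups of $\mathrm{Aut}(T_\infty)$. Moreover, $P_{r,s}:M_{r,s,\infty}\to\mathbb{Z}/2\mathbb{Z}$ is a homomorphism with kernel $B_{r,s,\infty}$.
   Context: $T_\infty$ is the infinite binary rooted tree whose nodes are finite words in $\{a,b\}$ (root = empty word, $w$ joined to $wa,wb$); $\mathrm{Aut}(T_\infty)$ is its automorphism group (length- and prefix-preserving permutations of words). For $\sigma\in\mathrm{Aut}(T_\infty)$ and a word $x$, $\mathrm{Par}(\sigma,x)\in\mathbb{Z}/2\mathbb{Z}$ is $0$ if $\sigma(xa)=\sigma(x)a$ and $1$ if $\sigma(xa)=\sigma(x)b$. Define $P^a_{r,s}(\sigma,x)=\sum_{w\in\{a,b\}^{r-1}}\mathrm{Par}(\sigma,xaw)+\sum_{w'\in\{a,b\}^{s-1}}\mathrm{Par}(\sigma,xbw')$ and $P^b_{r,s}(\sigma,x)=\sum_{w\in\{a,b\}^{r-1}}\mathrm{Par}(\sigma,xbw)+\sum_{w'\in\{a,b\}^{s-1}}\mathrm{Par}(\sigma,xaw')$ in $\mathbb{Z}/2\mathbb{Z}$. $M_{r,s,\infty}$ is the set of $\sigma\in\mathrm{Aut}(T_\infty)$ such that $P^a_{r,s}(\sigma,x_1)=P^b_{r,s}(\sigma,x_1)=P^a_{r,s}(\sigma,x_2)=P^b_{r,s}(\sigma,x_2)$ for all nodes $x_1,x_2$; for such $\sigma$, $P_{r,s}(\sigma)$ is this common value, and $B_{r,s,\infty}=\{\sigma\in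 M_{r,s,\infty}:P_{r,s}(\sigma)=0\}$. -}

module Defs where

open import Data.Bool using (Bool; true; false; _xor_)
open import Data.List using (List; []; _∷_; _++_; [_]; map; foldr; length; concatMap)
open import Data.List.Properties using (≡-dec)
open import Data.Nat using (ℕ; zero; suc; _∸_)
open import Data.Product using (Σ; ∃; _×_; _,_; proj₁; proj₂)
open import Function using (_∘_; id)
open import Relation.Binary.PropositionalEquality using (_≡_; refl; sym; trans; cong)
open import Relation.Nullary using (yes; no; Dec)

data Letter : Set where
  a b : Letter

_≟L_ : (x y : Letter) → Dec (x ≡ y)
a ≟L a = yes refl
a ≟L b = no λ ()
b ≟L a = no λ ()
b ≟L b = yes refl

-- Nodes of T∞: finite words; the children of w are w ++ [ a ] and w ++ [ b ]
Word : Set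
Word = List Letter

_≟W_ : (x y : Word) → Dec (x ≡ y)
_≟W_ = ≡-dec _≟L_

IsPrefix : Word → Word → Set
IsPrefix x y = ∃ λ z → x ++ z ≡ y

-- Z/2Z is represented by Bool with xor as addition (false = 0, true = 1)
Z2 : Set
Z2 = Bool

record Aut : Set where
  field
    fun      : Word → Word
    inv      : Word → Word
    inv-fun  : ∀ w → inv (fun w) ≡ w
    fun-inv  : ∀ w → fun (inv w) ≡ w
    len      : ∀ w → length (fun w) ≡ length w
    pref     : ∀ x y → IsPrefix x y → IsPrefix (fun x) (fun y)
    pref⁻    : ∀ x y → IsPrefix (fun x) (fun y) → IsPrefix x y
open Aut public

idAut : Aut
idAut = record
  { fun = id ; inv = id ; inv-fun = λ _ → refl ; fun-inv = λ _ → refl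
  ; len = λ _ → refl ; pref = λ _ _ p → p ; pref⁻ = λ _ _ p → p }

_∘A_ : Aut → Aut → Aut
σ ∘A τ = record
  { fun = fun σ ∘ fun τ
  ; inv = inv τ ∘ inv σ
  ; inv-fun = λ w → trans (cong (inv τ) (inv-fun σ (fun τ w))) (inv-fun τ w)
  ; fun-inv = λ w → trans (cong (fun σ) (fun-inv τ (inv σ w))) (fun-inv σ w)
  ; len = λ w → trans (len σ (fun τ w)) (len τ w)
  ; pref = λ x y p → pref σ _ _ (pref τ x y p)
  ; pref⁻ = λ x y p → pref⁻ τ x y (pref⁻ σ _ _ p) }

_⁻¹A : Aut → Aut
σ ⁻¹A = record
  { fun = inv σ
  ; inv = fun σ
  ; inv-fun = fun-inv σ
  ; fun-inv = inv-fun σ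
  ; len = λ w → trans (sym (len σ (inv σ w))) (cong length (fun-inv σ w))
  ; pref = λ x y p → pref⁻ σ _ _ (subst2 p (sym (fun-inv σ x)) (sym (fun-inv σ y)))
  ; pref⁻ = λ x y p → subst2 (pref σ _ _ p) (fun-inv σ x) (fun-inv σ y) }
  where
    subst2 : ∀ {u v u' v'} → IsPrefix u v → u ≡ u' → v ≡ v' → IsPrefix u' v'
    subst2 p refl refl = p

Par : Aut → Word → Z2
Par σ x with fun σ (x ++ [ a ]) ≟W (fun σ x ++ [ a ])
... | yes _ = false
... | no  _ = true

words : ℕ → List Word
words zero    = [] ∷ []
words (suc n) = concatMap (λ w → (a ∷ w) ∷ (b ∷ w) ∷ []) (words n)

Σ2 : List Z2 → Z2
Σ2 = foldr _xor_ false

sumPar : Aut → Word → Letter → ℕ → Z2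
sumPar σ x c n = Σ2 (map (λ w → Par σ (x ++ c ∷ w)) (words n))

Pa : ℕ → ℕ → Aut → Word → Z2
Pa r s σ x = sumPar σ x a (r ∸ 1) xor sumPar σ x b (s ∸ 1)

Pb : ℕ → ℕ → Aut → Word → Z2
Pb r s σ x = sumPar σ x b (r ∸ 1) xor sumPar σ x a (s ∸ 1)

InM : ℕ → ℕ → Aut → Set
InM r s σ = ∀ x₁ x₂ →
  (Pa r s σ x₁ ≡ Pb r s σ x₁) × (Pb r s σ x₁ ≡ Pa r s σ x₂) × (Pa r s σ x₂ ≡ Pb r s σ x₂)

-- P_{r,s}(σ): the common value (evaluated at the root; meaningful for σ ∈ M)
P : ℕ → ℕ → Aut → Z2
P r s σ = Pa r s σ []

InB : ℕ → ℕ → Aut → Set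
InB r s σ = InM r s σ × (P r s σ ≡ false)

IsSubgroup : (Aut → Set) → Set
IsSubgroup S = S idAut × (∀ σ τ → S σ → S τ → S (σ ∘A τ)) × (∀ σ → S σ → S (σ ⁻¹A))

module Submission where

-- Par σ x says whether σ swaps the two children of x, and it is a cocycle:
-- Par (σ ∘ τ) z = Par τ z + Par σ (τ z).  Summing this over the level sets of the
-- two subtrees below x, and using that τ carries the subtrees below x onto those
-- below τ x (swapping them exactly when Par τ x = 1), gives
--   P^ℓ (σ ∘ τ) x = P^ℓ τ x + P^(ℓ + Par τ x) σ (τ x)      (ℓ ∈ {a, b}).
-- Hence if both P^a and P^b are constant for σ and for τ, they are constant for
-- σ ∘ τ, with the sum of the two values; inverses follow from σ ∘ σ⁻¹ = id.

open import Defs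
open import Algebra.Bundles using (CommutativeRing)
open import Data.Bool using (Bool; true; false; _xor_)
open import Data.Bool.Properties using (xor-comm; xor-assoc; xor-identityʳ; xor-∧-commutativeRing)
open import Algebra.Properties.CommutativeSemigroup
  (CommutativeRing.+-commutativeSemigroup xor-∧-commutativeRing) using (interchange)
open import Data.Empty using (⊥; ⊥-elim)
open import Data.List using (List; []; _∷_; _++_; [_]; map; length; concatMap)
open import Data.List.Properties using (++-assoc; ++-identityʳ; ++-cancelˡ; length-++; map-cong)
open import Data.Nat using (ℕ; zero; suc; _+_; _<_; _≤_; _∸_)
open import Data.Nat.Properties using (+-cancelˡ-≡)
open import Data.Product using (∃; _×_; _,_; proj₁; proj₂)
open import Function using (_∘_)
open import Function.Bundles using (_⇔_; mk⇔)
open import Relation.Binary.PropositionalEquality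
  using (_≡_; _≗_; refl; sym; trans; cong; cong₂; module ≡-Reasoning)
open import Relation.Nullary using (yes; no)

open ≡-Reasoning

xor≡false⇒≡ : ∀ p q → p xor q ≡ false → p ≡ q
xor≡false⇒≡ false false _ = refl
xor≡false⇒≡ true  true  _ = refl

_⊕_ : Letter → Bool → Letter
ℓ ⊕ false = ℓ
a ⊕ true  = b
b ⊕ true  = a

⊕-xor : ∀ ℓ p q → (ℓ ⊕ p) ⊕ q ≡ ℓ ⊕ (p xor q)
⊕-xor ℓ false q     = refl
⊕-xor a true  false = refl
⊕-xor a true  true  = refl
⊕-xor b true  false = refl
⊕-xor b true  true  = refl

⊕-comm : ∀ ℓ p q → (ℓ ⊕ p) ⊕ q ≡ (ℓ ⊕ q) ⊕ p
⊕-comm ℓ p q = begin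
  (ℓ ⊕ p) ⊕ q   ≡⟨ ⊕-xor ℓ p q ⟩
  ℓ ⊕ (p xor q) ≡⟨ cong (ℓ ⊕_) (xor-comm p q) ⟩
  ℓ ⊕ (q xor p) ≡⟨ ⊕-xor ℓ q p ⟨
  (ℓ ⊕ q) ⊕ p   ∎

length≡1⇒singleton : (z : Word) → length z ≡ 1 → ∃ λ m → z ≡ [ m ]
length≡1⇒singleton (m ∷ []) _ = m , refl

fun-injective : ∀ σ {u v} → fun σ u ≡ fun σ v → u ≡ v
fun-injective σ {u} {v} eq = begin
  u                ≡⟨ inv-fun σ u ⟨
  inv σ (fun σ u)  ≡⟨ cong (inv σ) eq ⟩
  inv σ (fun σ v)  ≡⟨ inv-fun σ v ⟩
  v                ∎

image-suffix-length : ∀ σ x w z → fun σ x ++ z ≡ fun σ (x ++ w) → length z ≡ length w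
image-suffix-length σ x w z eq = +-cancelˡ-≡ (length (fun σ x)) _ _ (begin
  length (fun σ x) + length z   ≡⟨ length-++ (fun σ x) ⟨
  length (fun σ x ++ z)         ≡⟨ cong length eq ⟩
  length (fun σ (x ++ w))       ≡⟨ len σ (x ++ w) ⟩
  length (x ++ w)               ≡⟨ length-++ x ⟩
  length x + length w           ≡⟨ cong (_+ length w) (len σ x) ⟨
  length (fun σ x) + length w   ∎)

child-image : ∀ σ x ℓ → ∃ λ m → fun σ (x ++ [ ℓ ]) ≡ fun σ x ++ [ m ]
child-image σ x ℓ with pref σ x (x ++ [ ℓ ]) ([ ℓ ] , refl)
... | z , eq with length≡1⇒singleton z (image-suffix-length σ x [ ℓ ] z eq)
...   | m , refl = m , sym eq

children-images-distinct : ∀ σ x m →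
  fun σ (x ++ [ a ]) ≡ fun σ x ++ [ m ] → fun σ (x ++ [ b ]) ≡ fun σ x ++ [ m ] → ⊥
children-images-distinct σ x m ea eb
  with ++-cancelˡ x _ _ (fun-injective σ (trans ea (sym eb)))
... | ()

Par-unique : ∀ σ x p → fun σ (x ++ [ a ]) ≡ fun σ x ++ [ a ⊕ p ] → Par σ x ≡ p
Par-unique σ x p eq with fun σ (x ++ [ a ]) ≟W (fun σ x ++ [ a ])
Par-unique σ x false _  | yes _   = refl
Par-unique σ x true  eq | yes eq′ with ++-cancelˡ (fun σ x) _ _ (trans (sym eq′) eq)
... | ()
Par-unique σ x false eq | no neq  = ⊥-elim (neq eq)
Par-unique σ x true  _  | no _    = refl

fun-child : ∀ σ x ℓ → fun σ (x ++ [ ℓ ]) ≡ fun σ x ++ [ ℓ ⊕ Par σ x ]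
fun-child σ x ℓ with child-image σ x a | child-image σ x b
... | a , ea | a , eb = ⊥-elim (children-images-distinct σ x a ea eb)
... | b , ea | b , eb = ⊥-elim (children-images-distinct σ x b ea eb)
... | a , ea | b , eb rewrite Par-unique σ x false ea = on-child ℓ
  where
    on-child : ∀ ℓ → fun σ (x ++ [ ℓ ]) ≡ fun σ x ++ [ ℓ ⊕ false ]
    on-child a = ea
    on-child b = eb
... | b , ea | a , eb rewrite Par-unique σ x true ea = on-child ℓ
  where
    on-child : ∀ ℓ → fun σ (x ++ [ ℓ ]) ≡ fun σ x ++ [ ℓ ⊕ true ]
    on-child a = ea
    on-child b = eb

Par-∘ : ∀ σ τ z → Par (σ ∘A τ) z ≡ Par τ z xor Par σ (fun τ z)
Par-∘ σ τ z = Par-unique (σ ∘A τ) z _ (begin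
  fun σ (fun τ (z ++ [ a ]))                         ≡⟨ cong (fun σ) (fun-child τ z a) ⟩
  fun σ (fun τ z ++ [ a ⊕ p ])                       ≡⟨ fun-child σ (fun τ z) (a ⊕ p) ⟩
  fun σ (fun τ z) ++ [ (a ⊕ p) ⊕ q ]                 ≡⟨ cong (λ m → fun σ (fun τ z) ++ [ m ]) (⊕-xor a p q) ⟩
  fun σ (fun τ z) ++ [ a ⊕ (p xor q) ]               ∎)
  where
    p = Par τ z
    q = Par σ (fun τ z)

Par-trivial : ∀ σ → (∀ w → fun σ w ≡ w) → ∀ x → Par σ x ≡ false
Par-trivial σ fixes x = Par-unique σ x false
  (trans (fixes (x ++ [ a ])) (cong (_++ [ a ]) (sym (fixes x))))

subtreeSum : (Word → Z2) → Word → ℕ → Z2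
subtreeSum f y zero    = f y
subtreeSum f y (suc n) = subtreeSum f (y ++ [ a ]) n xor subtreeSum f (y ++ [ b ]) n

subtreeSum-cong : ∀ {f g} → f ≗ g → ∀ y n → subtreeSum f y n ≡ subtreeSum g y n
subtreeSum-cong f≗g y zero    = f≗g y
subtreeSum-cong f≗g y (suc n) =
  cong₂ _xor_ (subtreeSum-cong f≗g (y ++ [ a ]) n) (subtreeSum-cong f≗g (y ++ [ b ]) n)

subtreeSum-false : ∀ {f} → (∀ z → f z ≡ false) → ∀ y n → subtreeSum f y n ≡ false
subtreeSum-false f≡false y zero    = f≡false y
subtreeSum-false f≡false y (suc n) =
  cong₂ _xor_ (subtreeSum-false f≡false (y ++ [ a ]) n) (subtreeSum-false f≡false (y ++ [ b ]) n)

subtreeSum-xor : ∀ f g y n →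
  subtreeSum (λ z → f z xor g z) y n ≡ subtreeSum f y n xor subtreeSum g y n
subtreeSum-xor f g y zero    = refl
subtreeSum-xor f g y (suc n) =
  trans (cong₂ _xor_ (subtreeSum-xor f g (y ++ [ a ]) n) (subtreeSum-xor f g (y ++ [ b ]) n))
        (interchange (subtreeSum f (y ++ [ a ]) n) (subtreeSum g (y ++ [ a ]) n)
                     (subtreeSum f (y ++ [ b ]) n) (subtreeSum g (y ++ [ b ]) n))

subtreeSum-children-flip : ∀ f u n p →
  subtreeSum f (u ++ [ a ⊕ p ]) n xor subtreeSum f (u ++ [ b ⊕ p ]) n ≡ subtreeSum f u (suc n)
subtreeSum-children-flip f u n false = refl
subtreeSum-children-flip f u n true  =
  xor-comm (subtreeSum f (u ++ [ b ]) n) (subtreeSum f (u ++ [ a ]) n)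

subtreeSum-image : ∀ τ f y n → subtreeSum (f ∘ fun τ) y n ≡ subtreeSum f (fun τ y) n
subtreeSum-image τ f y zero    = refl
subtreeSum-image τ f y (suc n) = begin
  subtreeSum (f ∘ fun τ) (y ++ [ a ]) n xor subtreeSum (f ∘ fun τ) (y ++ [ b ]) n
    ≡⟨ cong₂ _xor_ (subtreeSum-image τ f (y ++ [ a ]) n) (subtreeSum-image τ f (y ++ [ b ]) n) ⟩
  subtreeSum f (fun τ (y ++ [ a ])) n xor subtreeSum f (fun τ (y ++ [ b ])) n
    ≡⟨ cong₂ (λ u v → subtreeSum f u n xor subtreeSum f v n) (fun-child τ y a) (fun-child τ y b) ⟩
  subtreeSum f (fun τ y ++ [ a ⊕ Par τ y ]) n xor subtreeSum f (fun τ y ++ [ b ⊕ Par τ y ]) n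
    ≡⟨ subtreeSum-children-flip f (fun τ y) n (Par τ y) ⟩
  subtreeSum f (fun τ y) (suc n) ∎

Σ2-concatMap-pair : ∀ {A B : Set} (g : B → Z2) (h₁ h₂ : A → B) (L : List A) →
  Σ2 (map g (concatMap (λ v → h₁ v ∷ h₂ v ∷ []) L))
    ≡ Σ2 (map (g ∘ h₁) L) xor Σ2 (map (g ∘ h₂) L)
Σ2-concatMap-pair g h₁ h₂ []      = refl
Σ2-concatMap-pair g h₁ h₂ (v ∷ L) = begin
  g (h₁ v) xor (g (h₂ v) xor Σ2 (map g (concatMap (λ v → h₁ v ∷ h₂ v ∷ []) L)))
    ≡⟨ cong (λ t → g (h₁ v) xor (g (h₂ v) xor t)) (Σ2-concatMap-pair g h₁ h₂ L) ⟩
  g (h₁ v) xor (g (h₂ v) xor (S₁ xor S₂))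
    ≡⟨ xor-assoc (g (h₁ v)) (g (h₂ v)) (S₁ xor S₂) ⟨
  (g (h₁ v) xor g (h₂ v)) xor (S₁ xor S₂)
    ≡⟨ interchange (g (h₁ v)) (g (h₂ v)) S₁ S₂ ⟩
  (g (h₁ v) xor S₁) xor (g (h₂ v) xor S₂) ∎
  where
    S₁ = Σ2 (map (g ∘ h₁) L)
    S₂ = Σ2 (map (g ∘ h₂) L)

Σ2-words≡subtreeSum : ∀ f y n → Σ2 (map (λ w → f (y ++ w)) (words n)) ≡ subtreeSum f y n
Σ2-words≡subtreeSum f y zero    = trans (xor-identityʳ (f (y ++ []))) (cong f (++-identityʳ y))
Σ2-words≡subtreeSum f y (suc n) =
  trans (Σ2-concatMap-pair (λ w → f (y ++ w)) (a ∷_) (b ∷_) (words n))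
        (cong₂ _xor_ (below a) (below b))
  where
    below : ∀ ℓ → Σ2 (map (λ v → f (y ++ ℓ ∷ v)) (words n)) ≡ subtreeSum f (y ++ [ ℓ ]) n
    below ℓ = trans (cong Σ2 (map-cong (λ v → cong f (sym (++-assoc y [ ℓ ] v))) (words n)))
                    (Σ2-words≡subtreeSum f (y ++ [ ℓ ]) n)

sumPar≡subtreeSum : ∀ σ x ℓ n → sumPar σ x ℓ n ≡ subtreeSum (Par σ) (x ++ [ ℓ ]) n
sumPar≡subtreeSum σ x ℓ n =
  trans (cong Σ2 (map-cong (λ w → cong (Par σ) (sym (++-assoc x [ ℓ ] w))) (words n)))
        (Σ2-words≡subtreeSum (Par σ) (x ++ [ ℓ ]) n)

sumPar-∘ : ∀ σ τ x ℓ n →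
  sumPar (σ ∘A τ) x ℓ n ≡ sumPar τ x ℓ n xor sumPar σ (fun τ x) (ℓ ⊕ Par τ x) n
sumPar-∘ σ τ x ℓ n = begin
  sumPar (σ ∘A τ) x ℓ n
    ≡⟨ sumPar≡subtreeSum (σ ∘A τ) x ℓ n ⟩
  subtreeSum (Par (σ ∘A τ)) xℓ n
    ≡⟨ subtreeSum-cong (Par-∘ σ τ) xℓ n ⟩
  subtreeSum (λ z → Par τ z xor Par σ (fun τ z)) xℓ n
    ≡⟨ subtreeSum-xor (Par τ) (Par σ ∘ fun τ) xℓ n ⟩
  subtreeSum (Par τ) xℓ n xor subtreeSum (Par σ ∘ fun τ) xℓ n
    ≡⟨ cong (subtreeSum (Par τ) xℓ n xor_) (subtreeSum-image τ (Par σ) xℓ n) ⟩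
  subtreeSum (Par τ) xℓ n xor subtreeSum (Par σ) (fun τ xℓ) n
    ≡⟨ cong (λ u → subtreeSum (Par τ) xℓ n xor subtreeSum (Par σ) u n) (fun-child τ x ℓ) ⟩
  subtreeSum (Par τ) xℓ n xor subtreeSum (Par σ) (fun τ x ++ [ ℓ ⊕ Par τ x ]) n
    ≡⟨ cong₂ _xor_ (sumPar≡subtreeSum τ x ℓ n) (sumPar≡subtreeSum σ (fun τ x) (ℓ ⊕ Par τ x) n) ⟨
  sumPar τ x ℓ n xor sumPar σ (fun τ x) (ℓ ⊕ Par τ x) n ∎
  where xℓ = x ++ [ ℓ ]

sumPar-trivial : ∀ σ → (∀ w → fun σ w ≡ w) → ∀ x ℓ n → sumPar σ x ℓ n ≡ false
sumPar-trivial σ fixes x ℓ n =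
  trans (sumPar≡subtreeSum σ x ℓ n) (subtreeSum-false (Par-trivial σ fixes) (x ++ [ ℓ ]) n)

module _ (r s : ℕ) where

  -- Pₗ r s σ a = Pa r s σ  and  Pₗ r s σ b = Pb r s σ  hold definitionally.
  Pₗ : Aut → Letter → Word → Z2
  Pₗ σ ℓ x = sumPar σ x ℓ (r ∸ 1) xor sumPar σ x (ℓ ⊕ true) (s ∸ 1)

  Pₗ-∘ : ∀ σ τ ℓ x → Pₗ (σ ∘A τ) ℓ x ≡ Pₗ τ ℓ x xor Pₗ σ (ℓ ⊕ Par τ x) (fun τ x)
  Pₗ-∘ σ τ ℓ x = begin
    sumPar (σ ∘A τ) x ℓ (r ∸ 1) xor sumPar (σ ∘A τ) x (ℓ ⊕ true) (s ∸ 1)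
      ≡⟨ cong₂ _xor_ (sumPar-∘ σ τ x ℓ (r ∸ 1)) (sumPar-∘ σ τ x (ℓ ⊕ true) (s ∸ 1)) ⟩
    (sumPar τ x ℓ (r ∸ 1) xor sumPar σ y (ℓ ⊕ p) (r ∸ 1))
      xor (sumPar τ x (ℓ ⊕ true) (s ∸ 1) xor sumPar σ y ((ℓ ⊕ true) ⊕ p) (s ∸ 1))
      ≡⟨ interchange (sumPar τ x ℓ (r ∸ 1)) (sumPar σ y (ℓ ⊕ p) (r ∸ 1))
                     (sumPar τ x (ℓ ⊕ true) (s ∸ 1)) (sumPar σ y ((ℓ ⊕ true) ⊕ p) (s ∸ 1)) ⟩
    Pₗ τ ℓ x xor (sumPar σ y (ℓ ⊕ p) (r ∸ 1) xor sumPar σ y ((ℓ ⊕ true) ⊕ p) (s ∸ 1))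
      ≡⟨ cong (λ m → Pₗ τ ℓ x xor (sumPar σ y (ℓ ⊕ p) (r ∸ 1) xor sumPar σ y m (s ∸ 1)))
              (⊕-comm ℓ true p) ⟩
    Pₗ τ ℓ x xor Pₗ σ (ℓ ⊕ p) y ∎
    where
      p = Par τ x
      y = fun τ x

  Pₗ-trivial : ∀ σ → (∀ w → fun σ w ≡ w) → ∀ ℓ x → Pₗ σ ℓ x ≡ false
  Pₗ-trivial σ fixes ℓ x =
    cong₂ _xor_ (sumPar-trivial σ fixes x ℓ (r ∸ 1)) (sumPar-trivial σ fixes x (ℓ ⊕ true) (s ∸ 1))

  ConstantP : Aut → Z2 → Set
  ConstantP σ k = ∀ ℓ x → Pₗ σ ℓ x ≡ k

  ConstantP-id : ConstantP idAut false
  ConstantP-id = Pₗ-trivial idAut (λ _ → refl)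

  ConstantP-∘ : ∀ {σ τ k m} → ConstantP σ k → ConstantP τ m → ConstantP (σ ∘A τ) (m xor k)
  ConstantP-∘ {σ} {τ} cσ cτ ℓ x =
    trans (Pₗ-∘ σ τ ℓ x) (cong₂ _xor_ (cτ ℓ x) (cσ (ℓ ⊕ Par τ x) (fun τ x)))

  ConstantP-⁻¹ : ∀ {σ k} → ConstantP σ k → ConstantP (σ ⁻¹A) k
  ConstantP-⁻¹ {σ} {k} cσ ℓ x = xor≡false⇒≡ _ k (begin
    Pₗ (σ ⁻¹A) ℓ x xor k                                   ≡⟨ cong (Pₗ (σ ⁻¹A) ℓ x xor_) (cσ _ _) ⟨
    Pₗ (σ ⁻¹A) ℓ x xor Pₗ σ (ℓ ⊕ Par (σ ⁻¹A) x) (inv σ x)   ≡⟨ Pₗ-∘ σ (σ ⁻¹A) ℓ x ⟨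
    Pₗ (σ ∘A (σ ⁻¹A)) ℓ x                                  ≡⟨ Pₗ-trivial (σ ∘A (σ ⁻¹A)) (fun-inv σ) ℓ x ⟩
    false                                                  ∎)

  InM⇒ConstantP : ∀ {σ} → InM r s σ → ConstantP σ (P r s σ)
  InM⇒ConstantP m a x = trans (proj₁ (m x [])) (proj₁ (proj₂ (m x [])))
  InM⇒ConstantP m b x = proj₁ (proj₂ (m x []))

  ConstantP⇒InM : ∀ {σ k} → ConstantP σ k → InM r s σ
  ConstantP⇒InM c x₁ x₂ =
    trans (c a x₁) (sym (c b x₁)) , trans (c b x₁) (sym (c a x₂)) , trans (c a x₂) (sym (c b x₂))

  InM-id : InM r s idAut
  InM-id = ConstantP⇒InM ConstantP-id

  InM-∘ : ∀ σ τ → InM r s σ → InM r s τ → InM r s (σ ∘A τ)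
  InM-∘ σ τ mσ mτ = ConstantP⇒InM (ConstantP-∘ (InM⇒ConstantP mσ) (InM⇒ConstantP mτ))

  InM-⁻¹ : ∀ σ → InM r s σ → InM r s (σ ⁻¹A)
  InM-⁻¹ σ mσ = ConstantP⇒InM (ConstantP-⁻¹ (InM⇒ConstantP mσ))

  P-id : P r s idAut ≡ false
  P-id = ConstantP-id a []

  P-∘ : ∀ σ τ → InM r s σ → InM r s τ → P r s (σ ∘A τ) ≡ (P r s σ xor P r s τ)
  P-∘ σ τ mσ mτ = trans (ConstantP-∘ (InM⇒ConstantP mσ) (InM⇒ConstantP mτ) a [])
                        (xor-comm (P r s τ) (P r s σ))

  P-⁻¹ : ∀ σ → InM r s σ → P r s (σ ⁻¹A) ≡ P r s σ
  P-⁻¹ σ mσ = ConstantP-⁻¹ (InM⇒ConstantP mσ) a []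

  InB-∘ : ∀ σ τ → InB r s σ → InB r s τ → InB r s (σ ∘A τ)
  InB-∘ σ τ (mσ , pσ) (mτ , pτ) = InM-∘ σ τ mσ mτ , trans (P-∘ σ τ mσ mτ) (cong₂ _xor_ pσ pτ)

  InB-⁻¹ : ∀ σ → InB r s σ → InB r s (σ ⁻¹A)
  InB-⁻¹ σ (mσ , pσ) = InM-⁻¹ σ mσ , trans (P-⁻¹ σ mσ) pσ

theorem3p3 : (r s : ℕ) → 1 ≤ s → s < r →
    IsSubgroup (InM r s) × IsSubgroup (InB r s)
    × (∀ σ τ → InM r s σ → InM r s τ → P r s (σ ∘A τ) ≡ (P r s σ xor P r s τ))
    × (∀ σ → InM r s σ → ((P r s σ ≡ false) ⇔ InB r s σ))
theorem3p3 r s _ _ =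
  (InM-id r s , InM-∘ r s , InM-⁻¹ r s) ,
  ((InM-id r s , P-id r s) , InB-∘ r s , InB-⁻¹ r s) ,
  P-∘ r s ,
  λ σ mσ → mk⇔ (mσ ,_) proj₂
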